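{- Let $B$ be an alternating sign matrix of order $n=2k+1$. Then there exist $n-1$ permutation matrices $P_1,\dots,P_k,P_{k+2},\dots,P_n$ of order $n$ such that $[P_1,\dots,P_k,B,P_{k+2},\dots,P_n]$ (with $B$ as the $(k+1)$st horizontal plane) is an $n\times n\times n$ alternating sign hypermatrix.
   Context: An $n\times n$ alternating sign matrix (ASM) is a $(0,\pm1)$-matrix whose rows and columns each have nonzeros alternating in sign beginning and ending with $+1$. An $n\times n\times n$ hypermatrix $[A_1,\dots,A_n]$ with horizontal planes $A_s=[a_{ijs}]_{i,j}$ is an alternating sign hypermatrix if every line (fix two of the indices, vary the third) has nonzeros alternating in sign beginning and ending with $+1$. -}

module Defs where

open import Data.Nat using (ℕ; suc; _+_; _*_)
open import Data.Integer using (ℤ; +_; -[1+_]; 0ℤ; 1ℤ)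
open import Data.Fin using (Fin; _≟_)
open import Data.Fin.Permutation using (Permutation′; _⟨$⟩ʳ_)
open import Data.List using (List; []; _∷_; filter; map)
open import Data.List.Relation.Unary.All using (All)
open import Data.Product using (∃; _×_)
open import Data.Sum using (_⊎_)
open import Relation.Binary.PropositionalEquality using (_≡_; _≢_)
open import Relation.Nullary using (¬?; does)
open import Data.Bool using (if_then_else_)
open import Data.Integer using () renaming (_≟_ to _≟ℤ_)
open import Data.List using (allFin)

-1ℤ : ℤ
-1ℤ = -[1+ 0 ]

IsSign : ℤ → Set
IsSign x = x ≡ 0ℤ ⊎ x ≡ 1ℤ ⊎ x ≡ -1ℤ

data AltPM : List ℤ → Set where
  alt-end  : AltPM (1ℤ ∷ [])
  alt-cons : ∀ {xs} → AltPM xs → AltPM (1ℤ ∷ -1ℤ ∷ xs)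

entries : ∀ {n} → (Fin n → ℤ) → List ℤ
entries {n} v = map v (allFin n)

nonzeros : List ℤ → List ℤ
nonzeros = filter (λ x → ¬? (x ≟ℤ 0ℤ))

AltSignLine : ∀ {n} → (Fin n → ℤ) → Set
AltSignLine v = All IsSign (entries v) × AltPM (nonzeros (entries v))

Matrix : ℕ → Set
Matrix n = Fin n → Fin n → ℤ

IsASM : ∀ {n} → Matrix n → Set
IsASM {n} A = (∀ i → AltSignLine (λ j → A i j)) × (∀ j → AltSignLine (λ i → A i j))

IsPermMatrix : ∀ {n} → Matrix n → Set
IsPermMatrix {n} P =
  ∃ λ (σ : Permutation′ n) → ∀ i j → P i j ≡ (if does ((σ ⟨$⟩ʳ i) ≟ j) then 1ℤ else 0ℤ)

-- hypermatrix with entries a i j s; horizontal plane s is the matrix (i , j) ↦ a i j s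
Hypermatrix : ℕ → Set
Hypermatrix n = Fin n → Fin n → Fin n → ℤ

IsASHM : ∀ {n} → Hypermatrix n → Set
IsASHM {n} a =
  (∀ i j → AltSignLine (λ s → a i j s)) ×
  (∀ i s → AltSignLine (λ j → a i j s)) ×
  (∀ j s → AltSignLine (λ i → a i j s))

module Submission where

-- Let Z and N be the 0/1 matrices marking the zeros and the −1's
-- of B.  In an alternating sign line #(+1) = #(−1) + 1, so #0 + 2·#(−1) = 2k:
-- the matrix Z ⊕ N ⊕ N has all line sums 2k.  Hence Z has even line sums, and
-- the even splitting lemma (an Euler-type argument, by induction on the total
-- of the matrix) writes Z = X ⊕ Y with X and Y having equal line sums; then
-- X ⊕ N and Y ⊕ N are k-regular.  By Kőnig's theorem each of them is a sum of
-- k permutation matrices, σ₁..σ_k resp. τ₁..τ_k.  Kőnig's theorem is proved by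
-- halving: a 2^t-regular matrix carrying less than 2^t off the support of G
-- splits t times into a permutation matrix inside G.  The hypermatrix has the
-- planes σ₁..σ_k, B, τ₁..τ_k.  Its horizontal lines are lines of B or of
-- permutation matrices; the vertical line through (i , j) has (X ⊕ N) i j ones
-- above B i j and (Y ⊕ N) i j ones below it, i.e. its nonzeros read 1, or
-- 1 −1 1 when B i j = −1.

open import Defs
open import Data.Nat using (ℕ; zero; suc; _+_; _*_; _∸_; _^_; _≤_; _<_; z≤n; s≤s; s≤s⁻¹; z<s; _≤?_)
open import Data.Nat.Properties hiding (_≟_)
open import Data.Nat.Divisibility using (_∣_; ∣1⇒≡1; ∣m+n∣m⇒∣n; m∣m*n)
open import Data.Nat.Induction using (<-rec)
open import Data.Nat.DivMod using (_%_; _/_; m≡m%n+[m/n]*n; m%n<n)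
open import Data.Integer using (ℤ; -[1+_]; 0ℤ; 1ℤ) renaming (+_ to ⁺_; _≟_ to _≟ℤ_)
open import Data.Fin using (Fin; toℕ; zero; suc; _≟_; cast; splitAt)
open import Data.Fin.Properties using (any?; cast-is-id; toℕ-cast; toℕ-injective; toℕ-↑ʳ; splitAt-↑ʳ; splitAt⁻¹-↑ʳ)
open import Data.Fin.Permutation using (Permutation′; _⟨$⟩ʳ_; _⟨$⟩ˡ_; permutation; inverseˡ; inverseʳ)
open import Data.Product using (Σ; _×_; _,_; ∃; proj₁; proj₂)
open import Data.Sum using (_⊎_; inj₁; inj₂; [_,_]′)
open import Data.Empty using (⊥-elim)
open import Function using (_∘_)
open import Data.List using (List; []; _∷_; _++_; tabulate; replicate)
open import Data.List.Properties using (map-tabulate; tabulate-cong; filter-++)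
open import Data.List.Relation.Unary.All using (All; []; _∷_)
open import Data.List.Relation.Unary.All.Properties using (++⁺; tabulate⁺; tabulate⁻)
open import Data.Bool using (Bool; true; false; if_then_else_)
open import Relation.Nullary using (¬_; does; yes; no; ¬?)
open import Relation.Nullary.Decidable using (_×-dec_)
open import Relation.Binary.PropositionalEquality
open import Algebra.Properties.Semiring.Sum +-*-semiring
  using (sum; sum-cong-≗; ∑-distrib-+; *-distribˡ-sum; *-distribʳ-sum)
open import Algebra.Properties.CommutativeSemigroup +-commutativeSemigroup
  using () renaming (xy∙z≈xz∙y to +-right-comm)
open import Data.Nat.Solver using (module +-*-Solver)
open +-*-Solver using (solve; _:+_; _:*_; _:=_; con)

private
  variable
    n : ℕ

δ : Fin n → Fin n → ℕ
δ a b = if does (a ≟ b) then 1 else 0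

δ-diag : (a : Fin n) → δ a a ≡ 1
δ-diag zero = refl
δ-diag (suc a) = δ-diag a

δ-off : {a b : Fin n} → a ≢ b → δ a b ≡ 0
δ-off {a = a} {b} a≢b with a ≟ b
... | yes a≡b = ⊥-elim (a≢b a≡b)
... | no _ = refl

sum-const : ∀ n c → sum {n} (λ _ → c) ≡ n * c
sum-const zero c = refl
sum-const (suc n) c = cong (c +_) (sum-const n c)

sum-δ : (a : Fin n) → sum (δ a) ≡ 1
sum-δ {suc n} zero = cong suc (trans (sum-const n 0) (*-zeroʳ n))
sum-δ {suc n} (suc a) = sum-δ a

sum-δˡ : (a : Fin n) → sum (λ i → δ i a) ≡ 1
sum-δˡ {suc n} zero = cong suc (trans (sum-const n 0) (*-zeroʳ n))
sum-δˡ {suc n} (suc a) = sum-δˡ a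

entry≤sum : (f : Fin n → ℕ) (a : Fin n) → f a ≤ sum f
entry≤sum f zero = m≤m+n (f zero) _
entry≤sum f (suc a) = ≤-trans (entry≤sum (λ j → f (suc j)) a) (m≤n+m _ (f zero))

pair≤sum : (f : Fin n → ℕ) {a b : Fin n} → a ≢ b → f a + f b ≤ sum f
pair≤sum f {zero} {zero} a≢b = ⊥-elim (a≢b refl)
pair≤sum f {zero} {suc b} _ = +-monoʳ-≤ (f zero) (entry≤sum (λ j → f (suc j)) b)
pair≤sum f {suc a} {zero} _ =
  subst (_≤ sum f) (+-comm (f zero) _) (+-monoʳ-≤ (f zero) (entry≤sum (λ j → f (suc j)) a))
pair≤sum f {suc a} {suc b} a≢b =
  ≤-trans (pair≤sum (λ j → f (suc j)) (λ a≡b → a≢b (cong suc a≡b))) (m≤n+m _ (f zero))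

sum-mono-≤ : {f g : Fin n → ℕ} → (∀ j → f j ≤ g j) → sum f ≤ sum g
sum-mono-≤ {zero} f≤g = z≤n
sum-mono-≤ {suc n} f≤g = +-mono-≤ (f≤g zero) (sum-mono-≤ (λ j → f≤g (suc j)))

sum-zeros : (f : Fin n → ℕ) → (∀ j → f j ≡ 0) → sum f ≡ 0
sum-zeros {n} f zeros = trans (sum-cong-≗ zeros) (trans (sum-const n 0) (*-zeroʳ n))

sum≡0 : (f : Fin n → ℕ) → sum f ≡ 0 → ∀ j → f j ≡ 0
sum≡0 f Σf≡0 j = n≤0⇒n≡0 (subst (f j ≤_) Σf≡0 (entry≤sum f j))

¬1≤⇒≡0 : ∀ {m} → ¬ (1 ≤ m) → m ≡ 0
¬1≤⇒≡0 ¬1≤m = n<1⇒n≡0 (≰⇒> ¬1≤m)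

positiveEntry : (f : Fin n → ℕ) → 1 ≤ sum f → ∃ λ j → 1 ≤ f j
positiveEntry f 1≤Σf with any? (λ j → 1 ≤? f j)
... | yes found = found
... | no none = ⊥-elim (1+n≢0 (n≤0⇒n≡0 (subst (1 ≤_) Σf≡0 1≤Σf)))
  where Σf≡0 = sum-zeros f (λ j → ¬1≤⇒≡0 (λ 1≤fj → none (j , 1≤fj)))

δ-characterisation : (f : Fin n → ℕ) (a : Fin n) → f a ≡ 1 → (∀ b → a ≢ b → f b ≡ 0) →
  ∀ j → f j ≡ δ a j
δ-characterisation f a fa≡1 others j with a ≟ j
... | yes refl = fa≡1
... | no a≢j = others j a≢j

δ≡1 : {a b : Fin n} → δ a b ≡ 1 → a ≡ b
δ≡1 {a = a} {b} δab≡1 with a ≟ b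
... | yes a≡b = a≡b
... | no _ = ⊥-elim (0≢1+n δab≡1)

sum≡1⇒δ : (f : Fin n → ℕ) → sum f ≡ 1 → ∃ λ a → ∀ j → f j ≡ δ a j
sum≡1⇒δ f Σf≡1 with positiveEntry f (≤-reflexive (sym Σf≡1))
... | a , 1≤fa = a , δ-characterisation f a fa≡1 others
  where
  fa≡1 : f a ≡ 1
  fa≡1 = ≤-antisym (subst (f a ≤_) Σf≡1 (entry≤sum f a)) 1≤fa
  others : ∀ b → a ≢ b → f b ≡ 0
  others b a≢b = n≤0⇒n≡0 (+-cancelˡ-≤ 1 (f b) 0
    (subst₂ (λ x y → x + f b ≤ y) fa≡1 Σf≡1 (pair≤sum f a≢b)))

-- If one entry of a vector with even sum is 1, some other entry is positive;
-- this finds the next edge of a trail in the even splitting lemma.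
secondPositive : (f : Fin n → ℕ) (a : Fin n) → f a ≡ 1 → 2 ∣ sum f → ∃ λ b → a ≢ b × 1 ≤ f b
secondPositive f a fa≡1 2∣Σf with any? (λ b → ¬? (a ≟ b) ×-dec (1 ≤? f b))
... | yes found = found
... | no none = ⊥-elim (2≢1 (∣1⇒≡1 (subst (2 ∣_) Σf≡1 2∣Σf)))
  where
  2≢1 : 2 ≢ 1
  2≢1 ()
  Σf≡1 : sum f ≡ 1
  Σf≡1 = trans (sum-cong-≗ (δ-characterisation f a fa≡1 λ b a≢b → ¬1≤⇒≡0 (λ 1≤fb → none (b , a≢b , 1≤fb))))
               (sum-δ a)

NatMatrix : ℕ → Set
NatMatrix n = Fin n → Fin n → ℕ

infix 4 _≐_
infixl 6 _⊕_

_≐_ : NatMatrix n → NatMatrix n → Set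
A ≐ B = ∀ i j → A i j ≡ B i j

_⊕_ : NatMatrix n → NatMatrix n → NatMatrix n
(A ⊕ B) i j = A i j + B i j

_ᵀ : NatMatrix n → NatMatrix n
(A ᵀ) i j = A j i

rowSum : NatMatrix n → Fin n → ℕ
rowSum A i = sum (A i)

colSum : NatMatrix n → Fin n → ℕ
colSum A = rowSum (A ᵀ)

total : NatMatrix n → ℕ
total A = sum (rowSum A)

rowSum-cong : {A B : NatMatrix n} → A ≐ B → ∀ i → rowSum A i ≡ rowSum B i
rowSum-cong A≐B i = sum-cong-≗ (A≐B i)

colSum-cong : {A B : NatMatrix n} → A ≐ B → ∀ j → colSum A j ≡ colSum B j
colSum-cong A≐B = rowSum-cong (λ j i → A≐B i j)

total-cong : {A B : NatMatrix n} → A ≐ B → total A ≡ total B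
total-cong A≐B = sum-cong-≗ (rowSum-cong A≐B)

rowSum-⊕ : (A B : NatMatrix n) → ∀ i → rowSum (A ⊕ B) i ≡ rowSum A i + rowSum B i
rowSum-⊕ A B i = ∑-distrib-+ (A i) (B i)

colSum-⊕ : (A B : NatMatrix n) → ∀ j → colSum (A ⊕ B) j ≡ colSum A j + colSum B j
colSum-⊕ A B = rowSum-⊕ (A ᵀ) (B ᵀ)

total-⊕ : (A B : NatMatrix n) → total (A ⊕ B) ≡ total A + total B
total-⊕ A B = trans (sum-cong-≗ (rowSum-⊕ A B)) (∑-distrib-+ (rowSum A) (rowSum B))

unit : Fin n → Fin n → NatMatrix n
unit r a i j = δ r i * δ a j

unit-diag : (r a : Fin n) → unit r a r a ≡ 1
unit-diag r a = cong₂ _*_ (δ-diag r) (δ-diag a)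

unit-away : {r a i j : Fin n} → r ≢ i ⊎ a ≢ j → unit r a i j ≡ 0
unit-away {r = r} {a} {i} {j} (inj₁ r≢i) = cong (_* δ a j) (δ-off r≢i)
unit-away {r = r} {a} {i} {j} (inj₂ a≢j) = trans (cong (δ r i *_) (δ-off a≢j)) (*-zeroʳ (δ r i))

⊕unit-positive : (A : NatMatrix n) (r a : Fin n) → 1 ≤ (A ⊕ unit r a) r a
⊕unit-positive A r a = subst (λ u → 1 ≤ A r a + u) (sym (unit-diag r a)) (m≤n+m 1 (A r a))

rowSum-⊕unit : (A : NatMatrix n) (r a i : Fin n) → rowSum (A ⊕ unit r a) i ≡ rowSum A i + δ r i
rowSum-⊕unit A r a i = begin
  rowSum (A ⊕ unit r a) i           ≡⟨ rowSum-⊕ A (unit r a) i ⟩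
  rowSum A i + sum (λ j → δ r i * δ a j) ≡⟨ cong (rowSum A i +_) (sym (*-distribˡ-sum (δ r i) (δ a))) ⟩
  rowSum A i + δ r i * sum (δ a)    ≡⟨ cong (λ s → rowSum A i + δ r i * s) (sum-δ a) ⟩
  rowSum A i + δ r i * 1            ≡⟨ cong (rowSum A i +_) (*-identityʳ (δ r i)) ⟩
  rowSum A i + δ r i                ∎
  where open ≡-Reasoning

colSum-⊕unit : (A : NatMatrix n) (r a j : Fin n) → colSum (A ⊕ unit r a) j ≡ colSum A j + δ a j
colSum-⊕unit A r a j = begin
  colSum (A ⊕ unit r a) j           ≡⟨ colSum-⊕ A (unit r a) j ⟩
  colSum A j + sum (λ i → δ r i * δ a j) ≡⟨ cong (colSum A j +_) (sym (*-distribʳ-sum (δ a j) (δ r))) ⟩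
  colSum A j + sum (δ r) * δ a j    ≡⟨ cong (λ s → colSum A j + s * δ a j) (sum-δ r) ⟩
  colSum A j + 1 * δ a j            ≡⟨ cong (colSum A j +_) (*-identityˡ (δ a j)) ⟩
  colSum A j + δ a j                ∎
  where open ≡-Reasoning

total-⊕unit : (A : NatMatrix n) (r a : Fin n) → total (A ⊕ unit r a) ≡ total A + 1
total-⊕unit A r a = begin
  total (A ⊕ unit r a)            ≡⟨ sum-cong-≗ (rowSum-⊕unit A r a) ⟩
  sum (λ i → rowSum A i + δ r i)  ≡⟨ ∑-distrib-+ (rowSum A) (δ r) ⟩
  total A + sum (δ r)             ≡⟨ cong (total A +_) (sum-δ r) ⟩
  total A + 1                     ∎
  where open ≡-Reasoning

-- Z with one unit taken away at (r , a).  When Z r a ≥ 1 this undoes adding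
-- a unit there, and it leaves every other entry unchanged.
removeUnit : Fin n → Fin n → NatMatrix n → NatMatrix n
removeUnit r a Z i j = Z i j ∸ unit r a i j

removeUnit-⊕ : (Z : NatMatrix n) (r a : Fin n) → 1 ≤ Z r a → Z ≐ removeUnit r a Z ⊕ unit r a
removeUnit-⊕ Z r a 1≤Zra i j = sym (m∸n+n≡m unit≤Z)
  where
  unit≤Z : unit r a i j ≤ Z i j
  unit≤Z with r ≟ i | a ≟ j
  ... | yes refl | yes refl = 1≤Zra
  ... | yes _    | no _     = z≤n
  ... | no _     | _        = z≤n

removeUnit-away : (Z : NatMatrix n) (r a : Fin n) {i j : Fin n} → r ≢ i ⊎ a ≢ j → removeUnit r a Z i j ≡ Z i j
removeUnit-away Z r a {i} {j} away = cong (Z i j ∸_) (unit-away away)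

removeUnit-diag : (Z : NatMatrix n) (r a : Fin n) → removeUnit r a Z r a ≡ Z r a ∸ 1
removeUnit-diag Z r a = cong (Z r a ∸_) (unit-diag r a)

Balanced : NatMatrix n → NatMatrix n → Set
Balanced X Y = (∀ i → rowSum X i ≡ rowSum Y i) × (∀ j → colSum X j ≡ colSum Y j)

EvenSplit : NatMatrix n → Set
EvenSplit {n} Z = Σ (NatMatrix n) λ X → Σ (NatMatrix n) λ Y → (X ⊕ Y ≐ Z) × Balanced X Y

EvenLines : NatMatrix n → Set
EvenLines Z = (∀ i → 2 ∣ rowSum Z i) × (∀ j → 2 ∣ colSum Z j)

balanced-⊕ : {X Y : NatMatrix n} (C : NatMatrix n) → Balanced X Y → Balanced (X ⊕ C) (Y ⊕ C)
balanced-⊕ {X = X} {Y} C (rows , cols) = sameRows X Y C rows , sameRows (X ᵀ) (Y ᵀ) (C ᵀ) cols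
  where
  sameRows : ∀ A B C → (∀ i → rowSum A i ≡ rowSum B i) → ∀ i → rowSum (A ⊕ C) i ≡ rowSum (B ⊕ C) i
  sameRows A B C rows i =
    trans (rowSum-⊕ A C i) (trans (cong (_+ rowSum C i) (rows i)) (sym (rowSum-⊕ B C i)))

evenSplit-resp : {Z Z′ : NatMatrix n} → Z ≐ Z′ → EvenSplit Z → EvenSplit Z′
evenSplit-resp Z≐Z′ (X , Y , X⊕Y≐Z , bal) = X , Y , (λ i j → trans (X⊕Y≐Z i j) (Z≐Z′ i j)) , bal

evenSplit-zero : (Z : NatMatrix n) → (∀ i j → Z i j ≡ 0) → EvenSplit Z
evenSplit-zero Z zeros =
  Z , Z , (λ i j → trans (cong (Z i j +_) (zeros i j)) (+-identityʳ (Z i j))) , (λ _ → refl) , (λ _ → refl)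

evenSplitWith : (Z : NatMatrix n) (s b : Fin n) → 1 ≤ Z s b → EvenSplit Z →
  Σ (EvenSplit Z) λ S → 1 ≤ proj₁ S s b
evenSplitWith Z s b 1≤Z S@(X , Y , X⊕Y≐Z , rows , cols) with 1 ≤? X s b
... | yes 1≤X = S , 1≤X
... | no ¬1≤X = swapped , subst (1 ≤_) Zsb≡Ysb 1≤Z
  where
  swapped : EvenSplit Z
  swapped = Y , X , (λ i j → trans (+-comm (Y i j) (X i j)) (X⊕Y≐Z i j)) , (λ i → sym (rows i)) , (λ j → sym (cols j))
  Zsb≡Ysb : Z s b ≡ Y s b
  Zsb≡Ysb = trans (sym (X⊕Y≐Z s b)) (cong (_+ Y s b) (¬1≤⇒≡0 ¬1≤X))

evenSplit-double : (W : NatMatrix n) (r a : Fin n) → EvenSplit W → EvenSplit (W ⊕ unit r a ⊕ unit r a)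
evenSplit-double W r a (X , Y , X⊕Y≐W , bal) =
  X ⊕ unit r a , Y ⊕ unit r a , sums , balanced-⊕ (unit r a) bal
  where
  sums : X ⊕ unit r a ⊕ (Y ⊕ unit r a) ≐ W ⊕ unit r a ⊕ unit r a
  sums i j = trans (solve 3 (λ x y u → x :+ u :+ (y :+ u) := x :+ y :+ u :+ u) refl (X i j) (Y i j) (unit r a i j))
                   (cong (λ w → w + unit r a i j + unit r a i j) (X⊕Y≐W i j))

-- The half containing (s , b) trades it for
-- (s , a) and (r , b), the other half receives (r , a); row s, row r, column a
-- and column b stay balanced.
evenSplit-reroute : (W : NatMatrix n) (r a s b : Fin n) →
  EvenSplit (W ⊕ unit s b) → EvenSplit (W ⊕ unit s a ⊕ unit r b ⊕ unit r a)
evenSplit-reroute W r a s b S′ with evenSplitWith (W ⊕ unit s b) s b (⊕unit-positive W s b) S′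
... | (X′ , Y′ , X′⊕Y′≐ , rows′ , cols′) , 1≤X′sb = X , Y , sums , rows , cols
  where
  X″ = removeUnit s b X′
  X′≐ : X′ ≐ X″ ⊕ unit s b
  X′≐ = removeUnit-⊕ X′ s b 1≤X′sb
  X = X″ ⊕ unit s a ⊕ unit r b
  Y = Y′ ⊕ unit r a
  X″⊕Y′≐W : X″ ⊕ Y′ ≐ W
  X″⊕Y′≐W i j = +-cancelʳ-≡ (unit s b i j) _ _ (begin
    X″ i j + Y′ i j + unit s b i j   ≡⟨ +-right-comm (X″ i j) _ _ ⟩
    X″ i j + unit s b i j + Y′ i j   ≡⟨ cong (_+ Y′ i j) (sym (X′≐ i j)) ⟩
    X′ i j + Y′ i j                  ≡⟨ X′⊕Y′≐ i j ⟩
    W i j + unit s b i j             ∎)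
    where open ≡-Reasoning
  sums : X ⊕ Y ≐ W ⊕ unit s a ⊕ unit r b ⊕ unit r a
  sums i j = trans (solve 5 (λ x y u v w → x :+ u :+ v :+ (y :+ w) := x :+ y :+ u :+ v :+ w) refl
                      (X″ i j) (Y′ i j) (unit s a i j) (unit r b i j) (unit r a i j))
                   (cong (λ w → w + unit s a i j + unit r b i j + unit r a i j) (X″⊕Y′≐W i j))
  rows : ∀ i → rowSum X i ≡ rowSum Y i
  rows i = begin
    rowSum X i                           ≡⟨ rowSum-⊕unit (X″ ⊕ unit s a) r b i ⟩
    rowSum (X″ ⊕ unit s a) i + δ r i     ≡⟨ cong (_+ δ r i) (rowSum-⊕unit X″ s a i) ⟩
    rowSum X″ i + δ s i + δ r i          ≡⟨ cong (_+ δ r i) (sym (rowSum-⊕unit X″ s b i)) ⟩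
    rowSum (X″ ⊕ unit s b) i + δ r i     ≡⟨ cong (_+ δ r i) (sym (rowSum-cong X′≐ i)) ⟩
    rowSum X′ i + δ r i                  ≡⟨ cong (_+ δ r i) (rows′ i) ⟩
    rowSum Y′ i + δ r i                  ≡⟨ sym (rowSum-⊕unit Y′ r a i) ⟩
    rowSum Y i                           ∎
    where open ≡-Reasoning
  cols : ∀ j → colSum X j ≡ colSum Y j
  cols j = begin
    colSum X j                           ≡⟨ colSum-⊕unit (X″ ⊕ unit s a) r b j ⟩
    colSum (X″ ⊕ unit s a) j + δ b j     ≡⟨ cong (_+ δ b j) (colSum-⊕unit X″ s a j) ⟩
    colSum X″ j + δ a j + δ b j          ≡⟨ +-right-comm (colSum X″ j) (δ a j) (δ b j) ⟩
    colSum X″ j + δ b j + δ a j          ≡⟨ cong (_+ δ a j) (sym (colSum-⊕unit X″ s b j)) ⟩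
    colSum (X″ ⊕ unit s b) j + δ a j     ≡⟨ cong (_+ δ a j) (sym (colSum-cong X′≐ j)) ⟩
    colSum X′ j + δ a j                  ≡⟨ cong (_+ δ a j) (cols′ j) ⟩
    colSum Y′ j + δ a j                  ≡⟨ sym (colSum-⊕unit Y′ r a j) ⟩
    colSum Y j                           ∎
    where open ≡-Reasoning

2∣-dropDouble : ∀ m d → 2 ∣ m + d + d → 2 ∣ m
2∣-dropDouble m d 2∣m+d+d = ∣m+n∣m⇒∣n (subst (2 ∣_) (solve 2 (λ m d → m :+ d :+ d := d :+ d :+ m) refl m d) 2∣m+d+d) 2∣d+d
  where
  2∣d+d : 2 ∣ d + d
  2∣d+d = subst (2 ∣_) (solve 1 (λ d → con 2 :* d := d :+ d) refl d) (m∣m*n d)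

evenLines-dropDouble : (Z Z′ : NatMatrix n) (dr dc : Fin n → ℕ) →
  (∀ i → rowSum Z i ≡ rowSum Z′ i + dr i + dr i) →
  (∀ j → colSum Z j ≡ colSum Z′ j + dc j + dc j) →
  EvenLines Z → EvenLines Z′
evenLines-dropDouble Z Z′ dr dc rows cols (evenRows , evenCols) =
  (λ i → 2∣-dropDouble (rowSum Z′ i) (dr i) (subst (2 ∣_) (rows i) (evenRows i))) ,
  (λ j → 2∣-dropDouble (colSum Z′ j) (dc j) (subst (2 ∣_) (cols j) (evenCols j)))

m<m+1+1 : ∀ m → m < m + 1 + 1
m<m+1+1 m = subst (m <_) (sym (+-assoc m 1 1)) (m<m+n m z<s)

removeDouble : (Z : NatMatrix n) (r a : Fin n) → 2 ≤ Z r a →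
  Σ (NatMatrix n) λ W → Z ≐ W ⊕ unit r a ⊕ unit r a
removeDouble Z r a 2≤Zra = removeUnit r a W₁ , Z≐
  where
  W₁ = removeUnit r a Z
  1≤W₁ra : 1 ≤ W₁ r a
  1≤W₁ra = subst (1 ≤_) (sym (removeUnit-diag Z r a)) (∸-monoˡ-≤ 1 2≤Zra)
  Z≐ : Z ≐ removeUnit r a W₁ ⊕ unit r a ⊕ unit r a
  Z≐ i j = trans (removeUnit-⊕ Z r a (≤-trans (n≤1+n 1) 2≤Zra) i j)
                 (cong (_+ unit r a i j) (removeUnit-⊕ W₁ r a 1≤W₁ra i j))

removePath : (Z : NatMatrix n) {r a s b : Fin n} → a ≢ b → r ≢ s →
  1 ≤ Z r a → 1 ≤ Z r b → 1 ≤ Z s a → Σ (NatMatrix n) λ W → Z ≐ W ⊕ unit s a ⊕ unit r b ⊕ unit r a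
removePath Z {r} {a} {s} {b} a≢b r≢s 1≤Zra 1≤Zrb 1≤Zsa = W , Z≐
  where
  W₁ = removeUnit r a Z
  W₂ = removeUnit r b W₁
  W = removeUnit s a W₂
  1≤W₁rb : 1 ≤ W₁ r b
  1≤W₁rb = subst (1 ≤_) (sym (removeUnit-away Z r a (inj₂ a≢b))) 1≤Zrb
  1≤W₂sa : 1 ≤ W₂ s a
  1≤W₂sa = subst (1 ≤_) (sym (trans (removeUnit-away W₁ r b (inj₁ r≢s)) (removeUnit-away Z r a (inj₁ r≢s)))) 1≤Zsa
  Z≐ : Z ≐ W ⊕ unit s a ⊕ unit r b ⊕ unit r a
  Z≐ i j = begin
    Z i j                                              ≡⟨ removeUnit-⊕ Z r a 1≤Zra i j ⟩
    W₁ i j + unit r a i j                              ≡⟨ cong (_+ unit r a i j) (removeUnit-⊕ W₁ r b 1≤W₁rb i j) ⟩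
    W₂ i j + unit r b i j + unit r a i j               ≡⟨ cong (λ w → w + unit r b i j + unit r a i j)
                                                               (removeUnit-⊕ W₂ s a 1≤W₂sa i j) ⟩
    W i j + unit s a i j + unit r b i j + unit r a i j ∎
    where open ≡-Reasoning

-- Contracting the path b — r — a — s of W ⊕ (s , a) ⊕ (r , b) ⊕ (r , a) to the
-- single unit (s , b) removes two units from row r, two from column a and two
-- from the total; all other line sums are unchanged.
module Contraction (W : NatMatrix n) (r a s b : Fin n) where

  path contracted : NatMatrix n
  path = W ⊕ unit s a ⊕ unit r b ⊕ unit r a
  contracted = W ⊕ unit s b

  rows : ∀ i → rowSum path i ≡ rowSum contracted i + δ r i + δ r i
  rows i = begin
    rowSum path i                               ≡⟨ rowSum-⊕unit (W ⊕ unit s a ⊕ unit r b) r a i ⟩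
    rowSum (W ⊕ unit s a ⊕ unit r b) i + δ r i  ≡⟨ cong (_+ δ r i) (rowSum-⊕unit (W ⊕ unit s a) r b i) ⟩
    rowSum (W ⊕ unit s a) i + δ r i + δ r i     ≡⟨ cong (λ x → x + δ r i + δ r i) (rowSum-⊕unit W s a i) ⟩
    rowSum W i + δ s i + δ r i + δ r i          ≡⟨ cong (λ x → x + δ r i + δ r i) (sym (rowSum-⊕unit W s b i)) ⟩
    rowSum contracted i + δ r i + δ r i         ∎
    where open ≡-Reasoning

  cols : ∀ j → colSum path j ≡ colSum contracted j + δ a j + δ a j
  cols j = begin
    colSum path j                               ≡⟨ colSum-⊕unit (W ⊕ unit s a ⊕ unit r b) r a j ⟩
    colSum (W ⊕ unit s a ⊕ unit r b) j + δ a j  ≡⟨ cong (_+ δ a j) (colSum-⊕unit (W ⊕ unit s a) r b j) ⟩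
    colSum (W ⊕ unit s a) j + δ b j + δ a j     ≡⟨ cong (λ x → x + δ b j + δ a j) (colSum-⊕unit W s a j) ⟩
    colSum W j + δ a j + δ b j + δ a j          ≡⟨ cong (_+ δ a j) (+-right-comm (colSum W j) (δ a j) (δ b j)) ⟩
    colSum W j + δ b j + δ a j + δ a j          ≡⟨ cong (λ x → x + δ a j + δ a j) (sym (colSum-⊕unit W s b j)) ⟩
    colSum contracted j + δ a j + δ a j         ∎
    where open ≡-Reasoning

  smaller : total contracted < total path
  smaller = subst (total contracted <_) (sym (begin
    total path                                  ≡⟨ total-⊕unit (W ⊕ unit s a ⊕ unit r b) r a ⟩
    total (W ⊕ unit s a ⊕ unit r b) + 1         ≡⟨ cong (_+ 1) (total-⊕unit (W ⊕ unit s a) r b) ⟩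
    total (W ⊕ unit s a) + 1 + 1                ≡⟨ cong (λ x → x + 1 + 1)
                                                        (trans (total-⊕unit W s a) (sym (total-⊕unit W s b))) ⟩
    total contracted + 1 + 1                    ∎)) (m<m+1+1 (total contracted))
    where open ≡-Reasoning

SplitsBelow : NatMatrix n → Set
SplitsBelow {n} Z = (Z′ : NatMatrix n) → total Z′ < total Z → EvenLines Z′ → EvenSplit Z′

-- Induction step when some entry Z r a ≥ 2: remove two units at (r , a),
-- split the rest and give one unit to each half.
splitDouble : (Z : NatMatrix n) (r a : Fin n) → 2 ≤ Z r a → SplitsBelow Z → EvenLines Z → EvenSplit Z
splitDouble Z r a 2≤Zra ih even =
  evenSplit-resp (λ i j → sym (Z≐ i j)) (evenSplit-double W r a (ih W smaller evenW))
  where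
  W = proj₁ (removeDouble Z r a 2≤Zra)
  Z≐ = proj₂ (removeDouble Z r a 2≤Zra)
  smaller : total W < total Z
  smaller = subst (total W <_)
    (sym (trans (total-cong Z≐) (trans (total-⊕unit (W ⊕ unit r a) r a) (cong (_+ 1) (total-⊕unit W r a)))))
    (m<m+1+1 (total W))
  evenW : EvenLines W
  evenW = evenLines-dropDouble Z W (δ r) (δ a)
    (λ i → trans (rowSum-cong Z≐ i) (trans (rowSum-⊕unit (W ⊕ unit r a) r a i) (cong (_+ δ r i) (rowSum-⊕unit W r a i))))
    (λ j → trans (colSum-cong Z≐ j) (trans (colSum-⊕unit (W ⊕ unit r a) r a j) (cong (_+ δ a j) (colSum-⊕unit W r a j))))
    even

-- Induction step when Z r a = 1: by evenness row r has another unit at (r , b)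
-- and column a another at (s , a).  Contracting the path b — r — a — s to the
-- single unit (s , b) lowers the total and keeps all line sums even; a
-- splitting of the contraction is rerouted back to one of Z.
splitReroute : (Z : NatMatrix n) (r a : Fin n) → Z r a ≡ 1 → SplitsBelow Z → EvenLines Z → EvenSplit Z
splitReroute Z r a Zra≡1 ih even@(evenRows , evenCols)
  with secondPositive (Z r) a Zra≡1 (evenRows r) | secondPositive (λ i → Z i a) r Zra≡1 (evenCols a)
... | b , a≢b , 1≤Zrb | s , r≢s , 1≤Zsa =
  evenSplit-resp (λ i j → sym (Z≐ i j)) (evenSplit-reroute W r a s b (ih contracted smallerZ evenContracted))
  where
  removal = removePath Z a≢b r≢s (≤-reflexive (sym Zra≡1)) 1≤Zrb 1≤Zsa
  W = proj₁ removal
  Z≐ = proj₂ removal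
  open Contraction W r a s b
  smallerZ : total contracted < total Z
  smallerZ = subst (total contracted <_) (sym (total-cong Z≐)) smaller
  evenContracted : EvenLines contracted
  evenContracted = evenLines-dropDouble Z contracted (δ r) (δ a)
    (λ i → trans (rowSum-cong Z≐ i) (rows i)) (λ j → trans (colSum-cong Z≐ j) (cols j)) even

evenSplit-step : (Z : NatMatrix n) → SplitsBelow Z → EvenLines Z → EvenSplit Z
evenSplit-step Z ih even with any? (λ r → any? (λ a → 1 ≤? Z r a))
... | no none = evenSplit-zero Z (λ r a → ¬1≤⇒≡0 (λ 1≤Zra → none (r , a , 1≤Zra)))
... | yes (r , a , 1≤Zra) with 2 ≤? Z r a
...   | yes 2≤Zra = splitDouble Z r a 2≤Zra ih even
...   | no 2≰Zra = splitReroute Z r a (≤-antisym (s≤s⁻¹ (≰⇒> 2≰Zra)) 1≤Zra) ih even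

evenSplit : (Z : NatMatrix n) → EvenLines Z → EvenSplit Z
evenSplit {n} Z = <-rec P step (total Z) Z refl
  where
  P : ℕ → Set
  P m = (Z : NatMatrix n) → total Z ≡ m → EvenLines Z → EvenSplit Z
  step : ∀ m → (∀ {m′} → m′ < m → P m′) → P m
  step _ rec Z refl = evenSplit-step Z (λ Z′ smaller → rec smaller Z′ refl)

Regular : ℕ → NatMatrix n → Set
Regular d Z = (∀ i → rowSum Z i ≡ d) × (∀ j → colSum Z j ≡ d)

regular-evenLines : ∀ h {Z : NatMatrix n} → Regular (2 * h) Z → EvenLines Z
regular-evenLines h (rows , cols) =
  (λ i → subst (2 ∣_) (sym (rows i)) (m∣m*n h)) , (λ j → subst (2 ∣_) (sym (cols j)) (m∣m*n h))

regular-halves : ∀ h {X Y Z : NatMatrix n} → Regular (2 * h) Z → X ⊕ Y ≐ Z → Balanced X Y →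
  Regular h X × Regular h Y
regular-halves h {X} {Y} (rowsZ , colsZ) X⊕Y≐Z (rows , cols) =
  (proj₁ ∘ halfRow , proj₁ ∘ halfCol) , (proj₂ ∘ halfRow , proj₂ ∘ halfCol)
  where
  halve : ∀ x y → x ≡ y → x + y ≡ 2 * h → x ≡ h × y ≡ h
  halve x y x≡y x+y≡2h = x≡h , trans (sym x≡y) x≡h
    where
    x≡h = *-cancelˡ-≡ x h 2 (trans (solve 1 (λ x → con 2 :* x := x :+ x) refl x)
                                   (trans (cong (x +_) x≡y) x+y≡2h))
  halfRow : ∀ i → rowSum X i ≡ h × rowSum Y i ≡ h
  halfRow i = halve _ _ (rows i)
    (trans (sym (rowSum-⊕ X Y i)) (trans (rowSum-cong X⊕Y≐Z i) (rowsZ i)))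
  halfCol : ∀ j → colSum X j ≡ h × colSum Y j ≡ h
  halfCol j = halve _ _ (cols j)
    (trans (sym (colSum-⊕ X Y j)) (trans (colSum-cong X⊕Y≐Z j) (colsZ j)))

regular-cancel : ∀ d e {A B C : NatMatrix n} → A ⊕ B ≐ C → Regular (d + e) C → Regular e B → Regular d A
regular-cancel d e {A} {B} A⊕B≐C (rowsC , colsC) (rowsB , colsB) =
  (λ i → +-cancelʳ-≡ e _ _ (trans (cong (rowSum A i +_) (sym (rowsB i)))
                           (trans (sym (rowSum-⊕ A B i)) (trans (rowSum-cong A⊕B≐C i) (rowsC i))))) ,
  (λ j → +-cancelʳ-≡ e _ _ (trans (cong (colSum A j +_) (sym (colsB j)))
                           (trans (sym (colSum-⊕ A B j)) (trans (colSum-cong A⊕B≐C j) (colsC j)))))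

identity : NatMatrix n
identity i j = δ i j

identity-regular : Regular {n} 1 identity
identity-regular = sum-δ , sum-δˡ

combination : ℕ → NatMatrix n → ℕ → NatMatrix n → NatMatrix n
combination α A β B i j = α * A i j + β * B i j

regular-combination : ∀ α β {d e} {A B : NatMatrix n} → Regular d A → Regular e B →
  Regular (α * d + β * e) (combination α A β B)
regular-combination α β {d} {e} {A} {B} (rowsA , colsA) (rowsB , colsB) =
  (λ i → trans (combinationRow A B i) (cong₂ (λ x y → α * x + β * y) (rowsA i) (rowsB i))) ,
  (λ j → trans (combinationRow (A ᵀ) (B ᵀ) j) (cong₂ (λ x y → α * x + β * y) (colsA j) (colsB j)))
  where
  combinationRow : ∀ A B i → rowSum (combination α A β B) i ≡ α * rowSum A i + β * rowSum B i
  combinationRow A B i = trans (rowSum-⊕ (λ i j → α * A i j) (λ i j → β * B i j) i)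
    (cong₂ _+_ (sym (*-distribˡ-sum α (A i))) (sym (*-distribˡ-sum β (B i))))

total-rowRegular : ∀ d (Z : NatMatrix n) → (∀ i → rowSum Z i ≡ d) → total Z ≡ n * d
total-rowRegular {n} d Z rows = trans (sum-cong-≗ rows) (sum-const n d)

isZeroℕ : ℕ → ℕ
isZeroℕ zero = 1
isZeroℕ (suc _) = 0

outside : NatMatrix n → NatMatrix n → NatMatrix n
outside G Z i j = isZeroℕ (G i j) * Z i j

offSupport : NatMatrix n → NatMatrix n → ℕ
offSupport G Z = total (outside G Z)

offSupport-⊕ : (G : NatMatrix n) {X Y Z : NatMatrix n} → X ⊕ Y ≐ Z →
  offSupport G X + offSupport G Y ≡ offSupport G Z
offSupport-⊕ G {X} {Y} X⊕Y≐Z = trans (sym (total-⊕ (outside G X) (outside G Y))) (total-cong λ i j →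
  trans (sym (*-distribˡ-+ (isZeroℕ (G i j)) (X i j) (Y i j))) (cong (isZeroℕ (G i j) *_) (X⊕Y≐Z i j)))

2^suc : ∀ t → 2 ^ suc t ≡ 2 ^ t + 2 ^ t
2^suc t = cong (2 ^ t +_) (+-identityʳ (2 ^ t))

m<2^m : ∀ m → m < 2 ^ m
m<2^m zero = z<s
m<2^m (suc m) = begin-strict
  suc m          <⟨ s≤s (m<2^m m) ⟩
  suc (2 ^ m)    ≡⟨ +-comm 1 (2 ^ m) ⟩
  2 ^ m + 1      ≤⟨ +-monoʳ-≤ (2 ^ m) (m^n>0 2 m) ⟩
  2 ^ m + 2 ^ m  ≡⟨ 2^suc m ⟨
  2 ^ suc m      ∎
  where open ≤-Reasoning

-- Halving argument: a 2^t-regular Z with less than 2^t off the support of G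
-- splits t times, always keeping the half lighter off the support of G, into a
-- 1-regular matrix inside the support of G.
regularWithin : (G : NatMatrix n) → ∀ t (Z : NatMatrix n) → Regular (2 ^ t) Z → offSupport G Z < 2 ^ t →
  Σ (NatMatrix n) λ P → Regular 1 P × offSupport G P ≡ 0
regularWithin G zero Z reg light = Z , reg , n<1⇒n≡0 light
regularWithin G (suc t) Z reg light with evenSplit Z (regular-evenLines (2 ^ t) reg)
... | X , Y , X⊕Y≐Z , bal with regular-halves (2 ^ t) reg X⊕Y≐Z bal
...   | regX , regY with 2 ^ t ≤? offSupport G X
...     | no X-light = regularWithin G t X regX (≰⇒> X-light)
...     | yes X-heavy = regularWithin G t Y regY (+-cancelˡ-< (offSupport G X) _ _ (begin-strict
  offSupport G X + offSupport G Y ≡⟨ offSupport-⊕ G X⊕Y≐Z ⟩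
  offSupport G Z                  <⟨ light ⟩
  2 ^ suc t                       ≡⟨ 2^suc t ⟩
  2 ^ t + 2 ^ t                   ≤⟨ +-monoˡ-≤ (2 ^ t) X-heavy ⟩
  offSupport G X + 2 ^ t          ∎))
  where open ≤-Reasoning

isZeroℕ-bound : ∀ α g c → isZeroℕ g * (α * g + c) ≤ c
isZeroℕ-bound α zero c = ≤-reflexive (trans (+-identityʳ _) (cong (_+ c) (*-zeroʳ α)))
isZeroℕ-bound α (suc g) c = z≤n

isZeroℕ-inside : ∀ g p → isZeroℕ g * p ≡ 0 → p ≤ 1 → p ≤ g
isZeroℕ-inside zero p off≡0 _ = ≤-reflexive (trans (sym (+-identityʳ p)) off≡0)
isZeroℕ-inside (suc g) p _ p≤1 = ≤-trans p≤1 (s≤s z≤n)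

-- With t = n(k+1) and
-- 2^t = α(k+1) + β, β ≤ k, the matrix α·G + β·I is 2^t-regular and carries at
-- most n·β ≤ t < 2^t off the support of G; now apply the halving argument.
regularOneWithin : ∀ k (G : NatMatrix n) → Regular (suc k) G →
  Σ (NatMatrix n) λ P → Regular 1 P × (∀ i j → P i j ≤ G i j)
regularOneWithin {n} k G regG = P , regP , P≤G
  where
  t = n * suc k
  α = 2 ^ t / suc k
  β = 2 ^ t % suc k
  Z = combination α G β identity
  regZ : Regular (2 ^ t) Z
  regZ = subst (λ d → Regular d Z) (trans (+-comm (α * suc k) (β * 1)) (trans (cong (_+ α * suc k) (*-identityʳ β))
               (sym (m≡m%n+[m/n]*n (2 ^ t) (suc k)))))
               (regular-combination α β regG identity-regular)
  βI : NatMatrix n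
  βI i j = β * δ i j
  lightZ : offSupport G Z < 2 ^ t
  lightZ = begin-strict
    offSupport G Z                    ≤⟨ sum-mono-≤ (λ i → sum-mono-≤ (λ j → isZeroℕ-bound α (G i j) (β * δ i j))) ⟩
    total βI                          ≡⟨ total-rowRegular β βI (λ i → trans (sym (*-distribˡ-sum β (δ i)))
                                                                   (trans (cong (β *_) (sum-δ i)) (*-identityʳ β))) ⟩
    n * β                             ≤⟨ *-monoʳ-≤ n (<⇒≤ (m%n<n (2 ^ t) (suc k))) ⟩
    t                                 <⟨ m<2^m t ⟩
    2 ^ t                             ∎
    where open ≤-Reasoning
  within = regularWithin G t Z regZ lightZ
  P = proj₁ within
  regP = proj₁ (proj₂ within)
  P≤G : ∀ i j → P i j ≤ G i j
  P≤G i j = isZeroℕ-inside (G i j) (P i j)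
    (sum≡0 (outside G P i) (sum≡0 (rowSum (outside G P)) (proj₂ (proj₂ within)) i) j)
    (subst (P i j ≤_) (proj₁ regP i) (entry≤sum (P i) j))

permMatrix : Permutation′ n → NatMatrix n
permMatrix π i j = δ (π ⟨$⟩ʳ i) j

perm-transpose : (π : Permutation′ n) (i j : Fin n) → does ((π ⟨$⟩ʳ i) ≟ j) ≡ does ((π ⟨$⟩ˡ j) ≟ i)
perm-transpose π i j with (π ⟨$⟩ʳ i) ≟ j | (π ⟨$⟩ˡ j) ≟ i
... | yes _ | yes _ = refl
... | no _  | no _  = refl
... | yes πi≡j | no π⁻¹j≢i = ⊥-elim (π⁻¹j≢i (trans (cong (π ⟨$⟩ˡ_) (sym πi≡j)) (inverseˡ π)))
... | no πi≢j | yes π⁻¹j≡i = ⊥-elim (πi≢j (trans (cong (π ⟨$⟩ʳ_) (sym π⁻¹j≡i)) (inverseʳ π)))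

regularOne⇒permutation : (P : NatMatrix n) → Regular 1 P → Σ (Permutation′ n) λ π → P ≐ permMatrix π
regularOne⇒permutation P (rows , cols) = permutation σ τ στ≡id τσ≡id , rowUnit
  where
  σ = λ i → proj₁ (sum≡1⇒δ (P i) (rows i))
  τ = λ j → proj₁ (sum≡1⇒δ (λ i → P i j) (cols j))
  rowUnit : ∀ i j → P i j ≡ δ (σ i) j
  rowUnit i = proj₂ (sum≡1⇒δ (P i) (rows i))
  colUnit : ∀ i j → P i j ≡ δ (τ j) i
  colUnit i j = proj₂ (sum≡1⇒δ (λ i → P i j) (cols j)) i
  στ≡id : ∀ j → σ (τ j) ≡ j
  στ≡id j = δ≡1 (trans (sym (rowUnit (τ j) j)) (trans (colUnit (τ j) j) (δ-diag (τ j))))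
  τσ≡id : ∀ i → τ (σ i) ≡ i
  τσ≡id i = δ≡1 (trans (sym (colUnit i (σ i))) (trans (rowUnit i (σ i)) (δ-diag (σ i))))

-- Kőnig's theorem: a k-regular matrix over ℕ is the sum of k permutation
-- matrices; peel off one permutation matrix inside G at a time.
PermutationSum : ℕ → NatMatrix n → Set
PermutationSum {n} k G = Σ (Fin k → Permutation′ n) λ σ → ∀ i j → G i j ≡ sum (λ t → permMatrix (σ t) i j)

regular⇒permutationSum : ∀ k (G : NatMatrix n) → Regular k G → PermutationSum k G
regular⇒permutationSum zero G (rows , _) = (λ ()) , λ i j → sum≡0 (G i) (rows i) j
regular⇒permutationSum {n} (suc k) G regG with regularOneWithin k G regG
... | P , regP , P≤G with regularOne⇒permutation P regP
...   | π , P≐π = σ , G≡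
  where
  G′ : NatMatrix n
  G′ i j = G i j ∸ P i j
  G′⊕P≐G : G′ ⊕ P ≐ G
  G′⊕P≐G i j = m∸n+n≡m (P≤G i j)
  rest : PermutationSum k G′
  rest = regular⇒permutationSum k G′ (regular-cancel k 1 G′⊕P≐G (subst (λ d → Regular d G) (+-comm 1 k) regG) regP)
  σ : Fin (suc k) → Permutation′ n
  σ zero = π
  σ (suc t) = proj₁ rest t
  G≡ : ∀ i j → G i j ≡ sum (λ t → permMatrix (σ t) i j)
  G≡ i j = trans (sym (G′⊕P≐G i j)) (trans (+-comm (G′ i j) (P i j)) (cong₂ _+_ (P≐π i j) (proj₂ rest i j)))

isZeroℤ : ℤ → ℕ
isZeroℤ (⁺ zero) = 1
isZeroℤ (⁺ suc _) = 0
isZeroℤ -[1+ _ ] = 0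

isPosℤ : ℤ → ℕ
isPosℤ (⁺ zero) = 0
isPosℤ (⁺ suc _) = 1
isPosℤ -[1+ _ ] = 0

isNegℤ : ℤ → ℕ
isNegℤ (⁺ _) = 0
isNegℤ -[1+ _ ] = 1

count : (ℤ → ℕ) → List ℤ → ℕ
count f [] = 0
count f (x ∷ xs) = f x + count f xs

count-entries : (f : ℤ → ℕ) (v : Fin n → ℤ) → count f (entries v) ≡ sum (λ j → f (v j))
count-entries f v = trans (cong (count f) (map-tabulate (λ j → j) v)) (countTabulate v)
  where
  countTabulate : ∀ {n} (v : Fin n → ℤ) → count f (tabulate v) ≡ sum (λ j → f (v j))
  countTabulate {zero} v = refl
  countTabulate {suc n} v = cong (f (v zero) +_) (countTabulate (λ j → v (suc j)))

count-nonzeros : (f : ℤ → ℕ) → f 0ℤ ≡ 0 → ∀ xs → count f (nonzeros xs) ≡ count f xs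
count-nonzeros f f0≡0 [] = refl
count-nonzeros f f0≡0 (⁺ zero ∷ xs) = trans (count-nonzeros f f0≡0 xs) (cong (_+ count f xs) (sym f0≡0))
count-nonzeros f f0≡0 (⁺ suc m ∷ xs) = cong (f (⁺ suc m) +_) (count-nonzeros f f0≡0 xs)
count-nonzeros f f0≡0 (-[1+ m ] ∷ xs) = cong (f -[1+ m ] +_) (count-nonzeros f f0≡0 xs)

altPM-count : ∀ {ys} → AltPM ys → count isPosℤ ys ≡ count isNegℤ ys + 1
altPM-count alt-end = refl
altPM-count (alt-cons alt) = cong suc (altPM-count alt)

-- In an alternating sign line of length n, #0 + 2·#(−1) + 1 = n, because the
-- +1's outnumber the −1's by one.
altSignLine-count : (v : Fin n → ℤ) → AltSignLine v →
  sum (λ j → isZeroℤ (v j) + isNegℤ (v j) + isNegℤ (v j)) + 1 ≡ n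
altSignLine-count {n} v (_ , alt) = +-cancelʳ-≡ negs _ _ (begin
  weights + 1 + negs                ≡⟨ +-assoc weights 1 negs ⟩
  weights + (1 + negs)              ≡⟨ cong (weights +_) (+-comm 1 negs) ⟩
  weights + (negs + 1)              ≡⟨ cong (weights +_) (sym positives≡negs+1) ⟩
  weights + positives               ≡⟨ sym (∑-distrib-+ (λ j → weight (v j)) (λ j → isPosℤ (v j))) ⟩
  sum (λ j → weight (v j) + isPosℤ (v j)) ≡⟨ sum-cong-≗ (λ j → weight+pos (v j)) ⟩
  sum (λ j → 1 + isNegℤ (v j))      ≡⟨ ∑-distrib-+ (λ _ → 1) (λ j → isNegℤ (v j)) ⟩
  sum {n} (λ _ → 1) + negs          ≡⟨ cong (_+ negs) (trans (sum-const n 1) (*-identityʳ n)) ⟩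
  n + negs                          ∎)
  where
  open ≡-Reasoning
  weight : ℤ → ℕ
  weight x = isZeroℤ x + isNegℤ x + isNegℤ x
  weight+pos : ∀ x → weight x + isPosℤ x ≡ 1 + isNegℤ x
  weight+pos (⁺ zero) = refl
  weight+pos (⁺ suc _) = refl
  weight+pos -[1+ _ ] = refl
  weights = sum (λ j → weight (v j))
  positives = sum (λ j → isPosℤ (v j))
  negs = sum (λ j → isNegℤ (v j))
  positives≡negs+1 : positives ≡ negs + 1
  positives≡negs+1 = begin
    positives                                  ≡⟨ count-entries isPosℤ v ⟨
    count isPosℤ (entries v)                   ≡⟨ count-nonzeros isPosℤ refl (entries v) ⟨
    count isPosℤ (nonzeros (entries v))        ≡⟨ altPM-count alt ⟩
    count isNegℤ (nonzeros (entries v)) + 1    ≡⟨ cong (_+ 1) (count-nonzeros isNegℤ refl (entries v)) ⟩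
    count isNegℤ (entries v) + 1               ≡⟨ cong (_+ 1) (count-entries isNegℤ v) ⟩
    negs + 1                                   ∎

AltSignList : List ℤ → Set
AltSignList l = All IsSign l × AltPM (nonzeros l)

entries-tabulate : (v : Fin n → ℤ) → entries v ≡ tabulate v
entries-tabulate v = map-tabulate (λ j → j) v

entrySign : (v : Fin n → ℤ) → AltSignLine v → ∀ j → IsSign (v j)
entrySign v (signs , _) = tabulate⁻ (subst (All IsSign) (entries-tabulate v) signs)

altSignLine-cong : {f g : Fin n → ℤ} → (∀ x → f x ≡ g x) → AltSignLine f → AltSignLine g
altSignLine-cong {f = f} {g} f≗g = subst AltSignList f≡g
  where
  f≡g : entries f ≡ entries g
  f≡g = trans (entries-tabulate f) (trans (tabulate-cong f≗g) (sym (entries-tabulate g)))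

zerosOf : Matrix n → NatMatrix n
zerosOf B i j = isZeroℤ (B i j)

negativesOf : Matrix n → NatMatrix n
negativesOf B i j = isNegℤ (B i j)

asm-regular : ∀ m (B : Matrix (m + 1)) → IsASM B → Regular m (zerosOf B ⊕ negativesOf B ⊕ negativesOf B)
asm-regular m B (rows , cols) =
  (λ i → +-cancelʳ-≡ 1 _ _ (altSignLine-count (λ j → B i j) (rows i))) ,
  (λ j → +-cancelʳ-≡ 1 _ _ (altSignLine-count (λ i → B i j) (cols j)))

bitLine : ∀ {m} → (Fin m → Bool) → Fin m → ℤ
bitLine h t = if h t then 1ℤ else 0ℤ

bitCount : ∀ {m} → (Fin m → Bool) → ℕ
bitCount h = sum (λ t → if h t then 1 else 0)

bitLine-signs : ∀ {m} (h : Fin m → Bool) → All IsSign (tabulate (bitLine h))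
bitLine-signs h = tabulate⁺ (λ t → bitSign (h t))
  where
  bitSign : ∀ b → IsSign (if b then 1ℤ else 0ℤ)
  bitSign true = inj₂ (inj₁ refl)
  bitSign false = inj₁ refl

bitLine-nonzeros : ∀ {m} (h : Fin m → Bool) → nonzeros (tabulate (bitLine h)) ≡ replicate (bitCount h) 1ℤ
bitLine-nonzeros {zero} h = refl
bitLine-nonzeros {suc m} h with h zero
... | true = cong (1ℤ ∷_) (bitLine-nonzeros (λ t → h (suc t)))
... | false = bitLine-nonzeros (λ t → h (suc t))

unitLine : (x : Fin n) → AltSignLine (bitLine (λ j → does (x ≟ j)))
unitLine x = subst AltSignList (sym (entries-tabulate (bitLine (λ j → does (x ≟ j)))))
  (bitLine-signs (λ j → does (x ≟ j)) ,
   subst AltPM (sym (trans (bitLine-nonzeros (λ j → does (x ≟ j))) (cong (λ m → replicate m 1ℤ) (sum-δ x)))) alt-end)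

permPlane : Permutation′ n → Matrix n
permPlane π i = bitLine (λ j → does ((π ⟨$⟩ʳ i) ≟ j))

permPlane-isPerm : (π : Permutation′ n) → IsPermMatrix (permPlane π)
permPlane-isPerm π = π , λ i j → refl

permPlane-rows : (π : Permutation′ n) → ∀ i → AltSignLine (λ j → permPlane π i j)
permPlane-rows π i = unitLine (π ⟨$⟩ʳ i)

permPlane-cols : (π : Permutation′ n) → ∀ j → AltSignLine (λ i → permPlane π i j)
permPlane-cols π j = altSignLine-cong (λ i → cong (if_then 1ℤ else 0ℤ) (sym (perm-transpose π i j))) (unitLine (π ⟨$⟩ˡ j))

-- Writing x + y = [b = 0], a line with
-- x + [b = −1] ones above the sign b and y + [b = −1] ones below it has
-- nonzeros 1 (from b = 0 or b = 1) or 1 −1 1 (from b = −1).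
stackedNonzeros : ∀ b x y → IsSign b → x + y ≡ isZeroℤ b →
  AltPM (replicate (x + isNegℤ b) 1ℤ ++ nonzeros (b ∷ []) ++ replicate (y + isNegℤ b) 1ℤ)
stackedNonzeros _ zero (suc zero) (inj₁ refl) refl = alt-end
stackedNonzeros _ (suc zero) zero (inj₁ refl) refl = alt-end
stackedNonzeros _ zero zero (inj₂ (inj₁ refl)) refl = alt-end
stackedNonzeros _ zero zero (inj₂ (inj₂ refl)) refl = alt-cons alt-end
stackedNonzeros _ zero zero (inj₁ refl) ()
stackedNonzeros _ zero (suc (suc _)) (inj₁ refl) ()
stackedNonzeros _ (suc zero) (suc _) (inj₁ refl) ()
stackedNonzeros _ (suc (suc _)) _ (inj₁ refl) ()
stackedNonzeros _ zero (suc _) (inj₂ (inj₁ refl)) ()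
stackedNonzeros _ (suc _) _ (inj₂ (inj₁ refl)) ()
stackedNonzeros _ zero (suc _) (inj₂ (inj₂ refl)) ()
stackedNonzeros _ (suc _) _ (inj₂ (inj₂ refl)) ()

stackedLine : ∀ {p q} (above : Fin p → Bool) (b : ℤ) (below : Fin q → Bool) x y → IsSign b →
  bitCount above ≡ x + isNegℤ b → bitCount below ≡ y + isNegℤ b → x + y ≡ isZeroℤ b →
  AltSignList (tabulate (bitLine above) ++ b ∷ tabulate (bitLine below))
stackedLine above b below x y sign-b #above #below x+y≡ =
  ++⁺ (bitLine-signs above) (sign-b ∷ bitLine-signs below) ,
  subst AltPM (sym nonzeros≡) (stackedNonzeros b x y sign-b x+y≡)
  where
  nonzero? = λ (z : ℤ) → ¬? (z ≟ℤ 0ℤ)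
  nonzeros≡ : nonzeros (tabulate (bitLine above) ++ b ∷ tabulate (bitLine below)) ≡
              replicate (x + isNegℤ b) 1ℤ ++ nonzeros (b ∷ []) ++ replicate (y + isNegℤ b) 1ℤ
  nonzeros≡ = trans (filter-++ nonzero? (tabulate (bitLine above)) (b ∷ tabulate (bitLine below)))
    (cong₂ _++_ (trans (bitLine-nonzeros above) (cong (λ m → replicate m 1ℤ) #above))
                (trans (filter-++ nonzero? (b ∷ []) (tabulate (bitLine below)))
                       (cong (nonzeros (b ∷ []) ++_) (trans (bitLine-nonzeros below) (cong (λ m → replicate m 1ℤ) #below)))))

tabulate-cast : ∀ {A : Set} {m m′} (m≡m′ : m ≡ m′) (f : Fin m′ → A) → tabulate (λ s → f (cast m≡m′ s)) ≡ tabulate f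
tabulate-cast refl f = tabulate-cong (λ s → cong f (cast-is-id refl s))

tabulate-splitAt : ∀ {A : Set} m {n} (g : Fin m ⊎ Fin n → A) →
  tabulate (λ s → g (splitAt m s)) ≡ tabulate (λ t → g (inj₁ t)) ++ tabulate (λ t → g (inj₂ t))
tabulate-splitAt zero g = refl
tabulate-splitAt (suc m) g = cong (g (inj₁ zero) ∷_) (tabulate-splitAt m (λ y → g ([ (λ t → inj₁ (suc t)) , inj₂ ]′ y)))

splitAt-middle : ∀ m {n} (s : Fin (m + suc n)) → toℕ s ≡ m → splitAt m s ≡ inj₂ zero
splitAt-middle m s s≡m = trans (cong (splitAt m) (toℕ-injective (trans s≡m (sym m+0)))) (splitAt-↑ʳ m _ zero)
  where m+0 = trans (toℕ-↑ʳ m zero) (+-identityʳ m)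

splitAt-middle⁻¹ : ∀ m {n} (s : Fin (m + suc n)) → splitAt m s ≡ inj₂ zero → toℕ s ≡ m
splitAt-middle⁻¹ m s eq = trans (cong toℕ (sym (splitAt⁻¹-↑ʳ eq))) (trans (toℕ-↑ʳ m zero) (+-identityʳ m))

module Stack {n : ℕ} (k : ℕ) (above : Fin k → Matrix n) (middle : Matrix n) (below : Fin k → Matrix n) where

  2k+1≡k+[1+k] : 2 * k + 1 ≡ k + suc k
  2k+1≡k+[1+k] = solve 1 (λ k → con 2 :* k :+ con 1 := k :+ (con 1 :+ k)) refl k

  -- Heights 0 … k−1 are `above`, height k is `middle`, heights k+1 … 2k are `below`.
  layer : Fin (2 * k + 1) → Fin k ⊎ Fin (suc k)
  layer s = splitAt k (cast 2k+1≡k+[1+k] s)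

  planeAt : Fin k ⊎ Fin (suc k) → Matrix n
  planeAt (inj₁ t) = above t
  planeAt (inj₂ zero) = middle
  planeAt (inj₂ (suc t)) = below t

  stack : Fin n → Fin n → Fin (2 * k + 1) → ℤ
  stack i j s = planeAt (layer s) i j

  layer-middle : ∀ s → toℕ s ≡ k → layer s ≡ inj₂ zero
  layer-middle s s≡k = splitAt-middle k _ (trans (toℕ-cast 2k+1≡k+[1+k] s) s≡k)

  layer-outer : ∀ s → toℕ s ≢ k → layer s ≢ inj₂ zero
  layer-outer s s≢k eq = s≢k (trans (sym (toℕ-cast 2k+1≡k+[1+k] s)) (splitAt-middle⁻¹ k _ eq))

  stack-middle : ∀ s → toℕ s ≡ k → ∀ i j → stack i j s ≡ middle i j
  stack-middle s s≡k i j = cong (λ x → planeAt x i j) (layer-middle s s≡k)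

  planeAt-outer : (P : Matrix n → Set) → (∀ t → P (above t)) → (∀ t → P (below t)) →
    ∀ x → x ≢ inj₂ zero → P (planeAt x)
  planeAt-outer P Pabove Pbelow (inj₁ t) _ = Pabove t
  planeAt-outer P Pabove Pbelow (inj₂ zero) x≢middle = ⊥-elim (x≢middle refl)
  planeAt-outer P Pabove Pbelow (inj₂ (suc t)) _ = Pbelow t

  planeAt-all : (P : Matrix n → Set) → (∀ t → P (above t)) → P middle → (∀ t → P (below t)) →
    ∀ x → P (planeAt x)
  planeAt-all P Pabove Pmiddle Pbelow (inj₂ zero) = Pmiddle
  planeAt-all P Pabove Pmiddle Pbelow x@(inj₁ _) = planeAt-outer P Pabove Pbelow x (λ ())
  planeAt-all P Pabove Pmiddle Pbelow x@(inj₂ (suc _)) = planeAt-outer P Pabove Pbelow x (λ ())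

  stack-outer : (P : Matrix n → Set) → (∀ t → P (above t)) → (∀ t → P (below t)) →
    ∀ s → toℕ s ≢ k → P (λ i j → stack i j s)
  stack-outer P Pabove Pbelow s s≢k = planeAt-outer P Pabove Pbelow (layer s) (layer-outer s s≢k)

  stack-planes : (P : Matrix n → Set) → (∀ t → P (above t)) → P middle → (∀ t → P (below t)) →
    ∀ s → P (λ i j → stack i j s)
  stack-planes P Pabove Pmiddle Pbelow s = planeAt-all P Pabove Pmiddle Pbelow (layer s)

  stack-vertical : ∀ i j → entries (λ s → stack i j s) ≡
    tabulate (λ t → above t i j) ++ middle i j ∷ tabulate (λ t → below t i j)
  stack-vertical i j = begin
    entries (λ s → stack i j s)                                   ≡⟨ entries-tabulate (λ s → stack i j s) ⟩
    tabulate (λ s → planeAt (splitAt k (cast 2k+1≡k+[1+k] s)) i j) ≡⟨ tabulate-cast 2k+1≡k+[1+k] (λ s → planeAt (splitAt k s) i j) ⟩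
    tabulate (λ s → planeAt (splitAt k s) i j)                    ≡⟨ tabulate-splitAt k (λ x → planeAt x i j) ⟩
    tabulate (λ t → above t i j) ++ middle i j ∷ tabulate (λ t → below t i j) ∎
    where open ≡-Reasoning

regular-evenPart : ∀ h (Z N : NatMatrix n) → Regular (2 * h) (Z ⊕ N ⊕ N) → EvenLines Z
regular-evenPart h Z N reg = evenLines-dropDouble (Z ⊕ N ⊕ N) Z (rowSum N) (colSum N)
  (λ i → trans (rowSum-⊕ (Z ⊕ N) N i) (cong (_+ rowSum N i) (rowSum-⊕ Z N i)))
  (λ j → trans (colSum-⊕ (Z ⊕ N) N j) (cong (_+ colSum N j) (colSum-⊕ Z N j)))
  (regular-evenLines h reg)

record Completion (h : ℕ) (Z N : NatMatrix n) : Set where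
  field
    upperPart lowerPart : NatMatrix n
    parts-⊕ : upperPart ⊕ lowerPart ≐ Z
    upper-regular : Regular h (upperPart ⊕ N)
    lower-regular : Regular h (lowerPart ⊕ N)

balancedCompletion : ∀ h (Z N : NatMatrix n) → Regular (2 * h) (Z ⊕ N ⊕ N) → Completion h Z N
balancedCompletion h Z N reg with evenSplit Z (regular-evenPart h Z N reg)
... | X , Y , X⊕Y≐Z , bal = record
  { upperPart = X ; lowerPart = Y ; parts-⊕ = X⊕Y≐Z
  ; upper-regular = proj₁ halves ; lower-regular = proj₂ halves }
  where
  sums : X ⊕ N ⊕ (Y ⊕ N) ≐ Z ⊕ N ⊕ N
  sums i j = trans (solve 3 (λ x y m → x :+ m :+ (y :+ m) := x :+ y :+ m :+ m) refl (X i j) (Y i j) (N i j))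
                   (cong (λ z → z + N i j + N i j) (X⊕Y≐Z i j))
  halves = regular-halves h reg sums (balanced-⊕ N bal)

theorem4p10 : (k : ℕ) (B : Matrix (2 * k + 1)) → IsASM B →
    Σ (Hypermatrix (2 * k + 1)) λ a →
    (∀ s → toℕ s ≡ k → ∀ i j → a i j s ≡ B i j) ×
    (∀ s → toℕ s ≢ k → IsPermMatrix (λ i j → a i j s)) ×
    IsASHM a
theorem4p10 k B asm =
  stack , stack-middle ,
  stack-outer IsPermMatrix (permPlane-isPerm ∘ σ) (permPlane-isPerm ∘ τ) ,
  vertical ,
  (λ i → stack-planes (λ M → AltSignLine (λ j → M i j))
           (λ t → permPlane-rows (σ t) i) (proj₁ asm i) (λ t → permPlane-rows (τ t) i)) ,
  (λ j → stack-planes (λ M → AltSignLine (λ i → M i j))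
           (λ t → permPlane-cols (σ t) j) (proj₂ asm j) (λ t → permPlane-cols (τ t) j))
  where
  N = negativesOf B
  open Completion (balancedCompletion k (zerosOf B) N (asm-regular (2 * k) B asm))
  upper = regular⇒permutationSum k (upperPart ⊕ N) upper-regular
  lower = regular⇒permutationSum k (lowerPart ⊕ N) lower-regular
  σ = proj₁ upper
  τ = proj₁ lower
  open Stack k (permPlane ∘ σ) B (permPlane ∘ τ)
  vertical : ∀ i j → AltSignLine (λ s → stack i j s)
  vertical i j = subst AltSignList (sym (stack-vertical i j))
    (stackedLine (λ t → does ((σ t ⟨$⟩ʳ i) ≟ j)) (B i j) (λ t → does ((τ t ⟨$⟩ʳ i) ≟ j))
                 (upperPart i j) (lowerPart i j)
                 (entrySign (λ j → B i j) (proj₁ asm i) j) (sym (proj₂ upper i j)) (sym (proj₂ lower i j))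
                 (parts-⊕ i j))
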